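{- With respect to frame definability, $\mathrm{ML} <_F \mathrm{ML}(\mathsf{A}^+) \equiv_F \bigvee\mathsf{A}\mathrm{ML} <_F \mathrm{ML}(\mathsf{A})$. Moreover, the same holds when one restricts attention to elementary frame classes.
   Context: Fix a set $\Phi$ of propositional variables. $\mathrm{ML}$: $\varphi ::= p \mid \neg p \mid (\varphi\wedge\varphi)\mid(\varphi\vee\varphi)\mid\Diamond\varphi\mid\Box\varphi$. $\mathrm{ML}(\mathsf{A})$ adds $\mathsf{A}\varphi$ and $\mathsf{E}\varphi$, with $\mathfrak{M},w\Vdash\mathsf{A}\varphi$ (resp. $\mathsf{E}\varphi$) iff $\varphi$ is true at every (resp. some) point of $\mathfrak{M}$; $\mathrm{ML}(\mathsf{A}^+)$ adds only $\mathsf{A}\varphi$. $\bigvee\mathsf{A}\mathrm{ML}$ is the set of closed disjunctive $\mathsf{A}$-clauses, i.e. formulas $\mathsf{A}\psi_1\vee\dots\vee\mathsf{A}\psi_n$ with $\psi_i\in\mathrm{ML}$. A set of formulas is valid in a frame if every formula is true at every point of every model on that frame; a class of frames is $L$-definable if it is the class of frames validating some set of $L$-formulas. $L\le_F L'$: every $L$-definable frame class is $L'$-definable; $L\equiv_F L'$: both directions; $L<_F L'$: $L\le_F L'$ and not $L'\le_F L$. A class is elementary if axiomatized by first-order sentences with equality over $\{R\}$; "restricting to elementary classes" means the relations are taken with respect to elementary frame classes only. -}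

module Defs where

open import Level using (Level; 0ℓ) renaming (suc to lsuc)
open import Data.Nat using (ℕ)
import Data.Nat as ℕ
open import Data.Fin using (Fin; zero; suc)
open import Data.Product using (Σ; _×_; _,_)
open import Data.Sum using (_⊎_)
open import Data.Empty using (⊥)
open import Data.Unit using (⊤)
open import Relation.Nullary using (¬_)
open import Relation.Binary.PropositionalEquality using (_≡_)

Var : Set
Var = ℕ

record Frame : Set₁ where
  field
    W : Set
    R : W → W → Set
open Frame public

Valuation : Frame → Set₁
Valuation F = Var → W F → Set

-- Syntax of ML(A) (negation normal form, as in the paper)

data Fm : Set where
  var  : Var → Fm
  nvar : Var → Fm
  _∧'_ : Fm → Fm → Fm
  _∨'_ : Fm → Fm → Fm
  ◇    : Fm → Fm
  □    : Fm → Fm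
  𝔸    : Fm → Fm
  𝔼    : Fm → Fm

sat : (F : Frame) → Valuation F → W F → Fm → Set
sat F V w (var p)   = V p w
sat F V w (nvar p)  = ¬ V p w
sat F V w (φ ∧' ψ)  = sat F V w φ × sat F V w ψ
sat F V w (φ ∨' ψ)  = sat F V w φ ⊎ sat F V w ψ
sat F V w (◇ φ)     = Σ (W F) λ v → R F w v × sat F V v φ
sat F V w (□ φ)     = (v : W F) → R F w v → sat F V v φ
sat F V w (𝔸 φ)     = (v : W F) → sat F V v φ
sat F V w (𝔼 φ)     = Σ (W F) λ v → sat F V v φ

_⊨_ : Frame → Fm → Set₁
F ⊨ φ = (V : Valuation F) (w : W F) → sat F V w φ

Language : Set₁
Language = Fm → Set

data isML : Fm → Set where
  var  : ∀ p → isML (var p)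
  nvar : ∀ p → isML (nvar p)
  and  : ∀ {φ ψ} → isML φ → isML ψ → isML (φ ∧' ψ)
  or   : ∀ {φ ψ} → isML φ → isML ψ → isML (φ ∨' ψ)
  dia  : ∀ {φ} → isML φ → isML (◇ φ)
  box  : ∀ {φ} → isML φ → isML (□ φ)

data isMLA⁺ : Fm → Set where
  var  : ∀ p → isMLA⁺ (var p)
  nvar : ∀ p → isMLA⁺ (nvar p)
  and  : ∀ {φ ψ} → isMLA⁺ φ → isMLA⁺ ψ → isMLA⁺ (φ ∧' ψ)
  or   : ∀ {φ ψ} → isMLA⁺ φ → isMLA⁺ ψ → isMLA⁺ (φ ∨' ψ)
  dia  : ∀ {φ} → isMLA⁺ φ → isMLA⁺ (◇ φ)
  box  : ∀ {φ} → isMLA⁺ φ → isMLA⁺ (□ φ)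
  univ : ∀ {φ} → isMLA⁺ φ → isMLA⁺ (𝔸 φ)

data is⋁AML : Fm → Set where
  clause : ∀ {ψ} → isML ψ → is⋁AML (𝔸 ψ)
  or     : ∀ {φ χ} → is⋁AML φ → is⋁AML χ → is⋁AML (φ ∨' χ)

isMLA : Fm → Set
isMLA _ = ⊤

FrameClass : Set₂
FrameClass = Frame → Set₁

Definable : Language → FrameClass → Set₁
Definable L K =
  Σ (Fm → Set) λ Γ →
    ((φ : Fm) → Γ φ → L φ) ×
    ((F : Frame) → (K F → (φ : Fm) → Γ φ → F ⊨ φ)
                 × (((φ : Fm) → Γ φ → F ⊨ φ) → K F))

-- formulas with n free variables (Fin n), de Bruijn style
data FO : ℕ → Set where
  eq   : ∀ {n} → Fin n → Fin n → FO n
  rel  : ∀ {n} → Fin n → Fin n → FO n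
  neg  : ∀ {n} → FO n → FO n
  and  : ∀ {n} → FO n → FO n → FO n
  or   : ∀ {n} → FO n → FO n → FO n
  imp  : ∀ {n} → FO n → FO n → FO n
  all  : ∀ {n} → FO (ℕ.suc n) → FO n
  ex   : ∀ {n} → FO (ℕ.suc n) → FO n

extend : ∀ {A : Set} {n} → A → (Fin n → A) → Fin (ℕ.suc n) → A
extend a ρ zero    = a
extend a ρ (suc i) = ρ i

foSat : (F : Frame) → ∀ {n} → (Fin n → W F) → FO n → Set
foSat F ρ (eq i j)  = ρ i ≡ ρ j
foSat F ρ (rel i j) = R F (ρ i) (ρ j)
foSat F ρ (neg α)   = ¬ foSat F ρ α
foSat F ρ (and α β) = foSat F ρ α × foSat F ρ β
foSat F ρ (or α β)  = foSat F ρ α ⊎ foSat F ρ β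
foSat F ρ (imp α β) = foSat F ρ α → foSat F ρ β
foSat F ρ (all α)   = (a : W F) → foSat F (extend a ρ) α
foSat F ρ (ex α)    = Σ (W F) λ a → foSat F (extend a ρ) α

Sentence : Set
Sentence = FO 0

_⊨FO_ : Frame → Sentence → Set
F ⊨FO σ = foSat F (λ ()) σ

Elementary : FrameClass → Set₁
Elementary K =
  Σ (Sentence → Set) λ T →
    (F : Frame) → (K F → (σ : Sentence) → T σ → F ⊨FO σ)
                × (((σ : Sentence) → T σ → F ⊨FO σ) → K F)

_≤F_ : Language → Language → Set₂
L ≤F L' = (K : FrameClass) → Definable L K → Definable L' K

_≡F_ : Language → Language → Set₂
L ≡F L' = (L ≤F L') × (L' ≤F L)

_<F_ : Language → Language → Set₂
L <F L' = (L ≤F L') × ¬ (L' ≤F L)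

_≤Fᵉ_ : Language → Language → Set₂
L ≤Fᵉ L' = (K : FrameClass) → Elementary K → Definable L K → Definable L' K

_≡Fᵉ_ : Language → Language → Set₂
L ≡Fᵉ L' = (L ≤Fᵉ L') × (L' ≤Fᵉ L)

_<Fᵉ_ : Language → Language → Set₂
L <Fᵉ L' = (L ≤Fᵉ L') × ¬ (L' ≤Fᵉ L)

-- Every ML(A⁺)-formula is equivalent, in each model, to a disjunction of
-- formulas 𝔸c ∧ ψ with c, ψ ∈ ML (its normal form). Since the truth of 𝔸c does
-- not depend on the point, 𝔸φ is then equivalent to the disjunction, over all
-- sublists S of the normal form, of 𝔸(⋁ψ_S ∧ ⋀c_S): one may take S to consist
-- of the disjuncts whose guard c is globally true. Hence every ML(A⁺)-formula
-- is valid in exactly the same frames as a disjunctive 𝔸-clause.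
-- For strictness: the elementary class of frames with at most one point is
-- defined by p ∨ 𝔸¬p but is not closed under disjoint unions, which preserve
-- ML-validity; the elementary class defined by 𝔼◇⊤ (every inhabited frame has
-- an edge) is not closed under disjoint summands, which reflect ⋁AML-validity.
module Submission where

open import Defs
open import Data.Product using (_×_)
open import Level using (0ℓ) renaming (suc to lsuc)
open import Axiom.ExcludedMiddle using (ExcludedMiddle)

open import Level using (Lift; lift; lower)
open import Function using (_∘_; id; _⇔_; mk⇔; Equivalence)
open import Data.Empty using (⊥; ⊥-elim)
open import Data.Unit using (⊤; tt)
open import Data.Fin using (zero; suc)
open import Data.Product using (Σ; ∃; ∃₂; _,_; proj₁; proj₂)
import Data.Product as Product
open import Data.Sum using (_⊎_; inj₁; inj₂; [_,_]′)
import Data.Sum as Sum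
open import Data.List using (List; []; _∷_; [_]; _++_; map; filter; cartesianProductWith)
open import Data.List.Relation.Unary.All using (All; []; _∷_)
import Data.List.Relation.Unary.All as All
import Data.List.Relation.Unary.All.Properties as AllP
open import Data.List.Relation.Unary.Any using (Any; here; there)
import Data.List.Relation.Unary.Any as Any
import Data.List.Relation.Unary.Any.Properties as AnyP
open import Data.List.Membership.Propositional using (find; lose)
open import Data.List.Relation.Binary.Sublist.Propositional using (_⊆_; []; _∷_; _∷ʳ_)
import Data.List.Relation.Binary.Sublist.Propositional as Sublist
open import Data.List.Relation.Binary.Sublist.Propositional.Properties using (filter-⊆)
open import Relation.Nullary using (¬_; yes; no)
open import Relation.Nullary.Decidable using (map′)
open import Relation.Unary using (Decidable)
open import Relation.Binary.PropositionalEquality using (_≡_; refl; sym; subst; setoid)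

open Equivalence using (to; from)

variable
  A : Set
  φ : Fm
  F G H : Frame
  L L′ : Language
  K : FrameClass

lowerEM : ExcludedMiddle (lsuc (lsuc 0ℓ)) → ExcludedMiddle 0ℓ
lowerEM em = map′ lower lift em

sublists : List A → List (List A)
sublists []       = [ [] ]
sublists (x ∷ xs) = map (x ∷_) (sublists xs) ++ sublists xs

Any-sublists⁺ : ∀ {T : List A → Set} {xs ys} → ys ⊆ xs → T ys → Any T (sublists xs)
Any-sublists⁺ []                    t = here t
Any-sublists⁺ (_ ∷ʳ ys⊆xs)          t = AnyP.++⁺ʳ _ (Any-sublists⁺ ys⊆xs t)
Any-sublists⁺ {xs = x ∷ _} (refl ∷ ys⊆xs) t =
  AnyP.++⁺ˡ (AnyP.map⁺ {f = x ∷_} (Any-sublists⁺ ys⊆xs t))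

Any-sublists⁻ : ∀ {T : List A → Set} xs → Any T (sublists xs) → ∃ λ ys → ys ⊆ xs × T ys
Any-sublists⁻ []       (here t) = [] , [] , t
Any-sublists⁻ (x ∷ xs) h with AnyP.++⁻ (map (x ∷_) (sublists xs)) h
... | inj₁ h′ = let ys , ys⊆xs , t = Any-sublists⁻ xs (AnyP.map⁻ h′)
                in x ∷ ys , refl ∷ ys⊆xs , t
... | inj₂ h′ = let ys , ys⊆xs , t = Any-sublists⁻ xs h′
                in ys , x ∷ʳ ys⊆xs , t

All-sublists⁺ : {P : A → Set} {xs : List A} → All P xs → All (All P) (sublists xs)
All-sublists⁺ []       = [] ∷ []
All-sublists⁺ (p ∷ ps) =
  AllP.++⁺ (AllP.map⁺ (All.map (p ∷_) (All-sublists⁺ ps))) (All-sublists⁺ ps)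

module _ {P Q : A → Set} where

  Any-zipAll : ∀ {xs} → All P xs → Any Q xs → Any (λ x → P x × Q x) xs
  Any-zipAll (p ∷ _)  (here q)  = here (p , q)
  Any-zipAll (_ ∷ ps) (there h) = there (Any-zipAll ps h)

  Any-filter⁺ : (P? : Decidable P) {xs : List A} → Any (λ x → P x × Q x) xs → Any Q (filter P? xs)
  Any-filter⁺ P? h with AnyP.filter⁺ P? h
  ... | inj₁ h′ = Any.map proj₂ h′
  ... | inj₂ ¬p = ⊥-elim (¬p (proj₁ (AnyP.lookup-result h)))

verum falsum : Fm
verum  = var 0 ∨' nvar 0
falsum = var 0 ∧' nvar 0

⋁ ⋀ : List Fm → Fm
⋁ []       = falsum
⋁ (φ ∷ φs) = φ ∨' ⋁ φs
⋀ []       = verum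
⋀ (φ ∷ φs) = φ ∧' ⋀ φs

-- ⋁AML has no empty disjunction, so the empty case is the unsatisfiable clause 𝔸 falsum.
⋁𝔸 : List Fm → Fm
⋁𝔸 []       = 𝔸 falsum
⋁𝔸 (φ ∷ φs) = 𝔸 φ ∨' ⋁𝔸 φs

verum-ML : isML verum
verum-ML = or (var 0) (nvar 0)

falsum-ML : isML falsum
falsum-ML = and (var 0) (nvar 0)

⋁-ML : ∀ {φs} → All isML φs → isML (⋁ φs)
⋁-ML []       = falsum-ML
⋁-ML (p ∷ ps) = or p (⋁-ML ps)

⋀-ML : ∀ {φs} → All isML φs → isML (⋀ φs)
⋀-ML []       = verum-ML
⋀-ML (p ∷ ps) = and p (⋀-ML ps)

⋁𝔸-⋁AML : ∀ {φs} → All isML φs → is⋁AML (⋁𝔸 φs)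
⋁𝔸-⋁AML []       = clause falsum-ML
⋁𝔸-⋁AML (p ∷ ps) = or (clause p) (⋁𝔸-⋁AML ps)

ML⊆MLA⁺ : isML φ → isMLA⁺ φ
ML⊆MLA⁺ (var p)   = var p
ML⊆MLA⁺ (nvar p)  = nvar p
ML⊆MLA⁺ (and l r) = and (ML⊆MLA⁺ l) (ML⊆MLA⁺ r)
ML⊆MLA⁺ (or l r)  = or (ML⊆MLA⁺ l) (ML⊆MLA⁺ r)
ML⊆MLA⁺ (dia l)   = dia (ML⊆MLA⁺ l)
ML⊆MLA⁺ (box l)   = box (ML⊆MLA⁺ l)

⋁AML⊆MLA⁺ : is⋁AML φ → isMLA⁺ φ
⋁AML⊆MLA⁺ (clause l) = univ (ML⊆MLA⁺ l)
⋁AML⊆MLA⁺ (or l r)   = or (⋁AML⊆MLA⁺ l) (⋁AML⊆MLA⁺ r)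

-- c ▸ ψ stands for 𝔸 c ∧ ψ.
record Guarded : Set where
  constructor _▸_
  field
    guard : Fm
    body  : Fm
open Guarded

GuardedML : Guarded → Set
GuardedML g = isML (guard g) × isML (body g)

_⊓_ : Guarded → Guarded → Guarded
(c ▸ φ) ⊓ (d ▸ ψ) = (c ∧' d) ▸ (φ ∧' ψ)

◇▸ : Guarded → Guarded
◇▸ (c ▸ φ) = c ▸ ◇ φ

□▸ : List Guarded → Guarded
□▸ gs = ⋀ (map guard gs) ▸ □ (⋁ (map body gs))

globalClause : List Guarded → Fm
globalClause gs = ⋁ (map body gs) ∧' ⋀ (map guard gs)

𝔸▸ : List Guarded → Guarded
𝔸▸ gs = globalClause gs ▸ verum

normalForm : isMLA⁺ φ → List Guarded
normalForm (var p)   = [ verum ▸ var p ]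
normalForm (nvar p)  = [ verum ▸ nvar p ]
normalForm (and l r) = cartesianProductWith _⊓_ (normalForm l) (normalForm r)
normalForm (or l r)  = normalForm l ++ normalForm r
normalForm (dia l)   = map ◇▸ (normalForm l)
normalForm (box l)   = map □▸ (sublists (normalForm l))
normalForm (univ l)  = map 𝔸▸ (sublists (normalForm l))

translate : isMLA⁺ φ → Fm
translate l = ⋁𝔸 (map globalClause (sublists (normalForm l)))

globalClause-ML : ∀ {gs} → All GuardedML gs → isML (globalClause gs)
globalClause-ML gs-ML =
  and (⋁-ML (AllP.map⁺ (All.map proj₂ gs-ML))) (⋀-ML (AllP.map⁺ (All.map proj₁ gs-ML)))

normalForm-ML : (l : isMLA⁺ φ) → All GuardedML (normalForm l)
normalForm-ML (var p)   = (verum-ML , var p) ∷ []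
normalForm-ML (nvar p)  = (verum-ML , nvar p) ∷ []
normalForm-ML (and l r) =
  AllP.cartesianProductWith⁺ (setoid _) (setoid _) _⊓_ (normalForm l) (normalForm r)
    λ g∈ h∈ → let c , φ = All.lookup (normalForm-ML l) g∈
                  d , ψ = All.lookup (normalForm-ML r) h∈
              in and c d , and φ ψ
normalForm-ML (or l r)  = AllP.++⁺ (normalForm-ML l) (normalForm-ML r)
normalForm-ML (dia l)   = AllP.map⁺ (All.map (Product.map₂ dia) (normalForm-ML l))
normalForm-ML (box l)   = AllP.map⁺ (All.map □▸-ML (All-sublists⁺ (normalForm-ML l)))
  where
  □▸-ML : ∀ {gs} → All GuardedML gs → GuardedML (□▸ gs)
  □▸-ML gs-ML =
    ⋀-ML (AllP.map⁺ (All.map proj₁ gs-ML)) , box (⋁-ML (AllP.map⁺ (All.map proj₂ gs-ML)))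
normalForm-ML (univ l)  =
  AllP.map⁺ (All.map (λ gs-ML → globalClause-ML gs-ML , verum-ML) (All-sublists⁺ (normalForm-ML l)))

translate-⋁AML : (l : isMLA⁺ φ) → is⋁AML (translate l)
translate-⋁AML l =
  ⋁𝔸-⋁AML (AllP.map⁺ (All.map globalClause-ML (All-sublists⁺ (normalForm-ML l))))

module Semantics (em : ExcludedMiddle 0ℓ) {F : Frame} (V : Valuation F) where

  infix 4 _⊩_
  _⊩_ : W F → Fm → Set
  w ⊩ φ = sat F V w φ

  Global : Fm → Set
  Global φ = ∀ v → v ⊩ φ

  ⊩-verum : Global verum
  ⊩-verum w with em {V 0 w}
  ... | yes p = inj₁ p
  ... | no ¬p = inj₂ ¬p

  ⊩-⋁⁺ : ∀ {w} φs → Any (w ⊩_) φs → w ⊩ ⋁ φs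
  ⊩-⋁⁺ (_ ∷ _)  (here s)  = inj₁ s
  ⊩-⋁⁺ (_ ∷ φs) (there h) = inj₂ (⊩-⋁⁺ φs h)

  ⊩-⋁⁻ : ∀ {w} φs → w ⊩ ⋁ φs → Any (w ⊩_) φs
  ⊩-⋁⁻ []       (s , ¬s)  = ⊥-elim (¬s s)
  ⊩-⋁⁻ (_ ∷ _)  (inj₁ s) = here s
  ⊩-⋁⁻ (_ ∷ φs) (inj₂ s) = there (⊩-⋁⁻ φs s)

  Global-⋀⁺ : ∀ φs → All Global φs → Global (⋀ φs)
  Global-⋀⁺ []       []       = ⊩-verum
  Global-⋀⁺ (_ ∷ φs) (g ∷ gs) v = g v , Global-⋀⁺ φs gs v

  Global-⋀⁻ : ∀ φs → Global (⋀ φs) → All Global φs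
  Global-⋀⁻ []       _ = []
  Global-⋀⁻ (_ ∷ φs) g = (proj₁ ∘ g) ∷ Global-⋀⁻ φs (proj₂ ∘ g)

  ⊩-⋁𝔸⁺ : ∀ {w} φs → Any Global φs → w ⊩ ⋁𝔸 φs
  ⊩-⋁𝔸⁺ (_ ∷ _)  (here g)  = inj₁ g
  ⊩-⋁𝔸⁺ (_ ∷ φs) (there h) = inj₂ (⊩-⋁𝔸⁺ φs h)

  ⊩-⋁𝔸⁻ : ∀ {w} φs → w ⊩ ⋁𝔸 φs → Any Global φs
  ⊩-⋁𝔸⁻ {w} []       g        = ⊥-elim (proj₂ (g w) (proj₁ (g w)))
  ⊩-⋁𝔸⁻     (_ ∷ _)  (inj₁ g) = here g
  ⊩-⋁𝔸⁻     (_ ∷ φs) (inj₂ s) = there (⊩-⋁𝔸⁻ φs s)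

  Holds : W F → Guarded → Set
  Holds w g = Global (guard g) × w ⊩ body g

  NormalForm : Fm → List Guarded → Set
  NormalForm φ gs = ∀ w → w ⊩ φ ⇔ Any (Holds w) gs

  Covers : (W F → Set) → List Guarded → Set
  Covers U gs = All (Global ∘ guard) gs × (∀ v → U v → Any ((v ⊩_) ∘ body) gs)

  -- Global truth of a guard does not depend on the point, so the sublist of
  -- globally true guards works for all points of U at once.
  ∀Any-Holds⇔Covers : ∀ {U} gs →
    (∀ v → U v → Any (Holds v) gs) ⇔ (∃ λ hs → hs ⊆ gs × Covers U hs)
  ∀Any-Holds⇔Covers gs = mk⇔
    (λ h → filter global? gs , filter-⊆ global? gs , AllP.all-filter global? gs ,
           λ v u → Any-filter⁺ global? (h v u))
    (λ (hs , hs⊆gs , hs-global , covered) v u →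
      Sublist.lookup hs⊆gs (Any-zipAll hs-global (covered v u)))
    where
    global? : Decidable (Global ∘ guard)
    global? _ = em

  ∀-normal : ∀ {U T gs} → NormalForm φ gs → (∀ hs → T hs ⇔ Covers U hs) →
             (∀ v → U v → v ⊩ φ) ⇔ Any T (sublists gs)
  ∀-normal {gs = gs} nf T⇔Covers = mk⇔
    (λ ∀φ → let hs , hs⊆gs , covered = to (∀Any-Holds⇔Covers gs) (λ v u → to (nf v) (∀φ v u))
            in Any-sublists⁺ hs⊆gs (from (T⇔Covers hs) covered))
    (λ h v u → let hs , hs⊆gs , t = Any-sublists⁻ gs h
               in from (nf v) (from (∀Any-Holds⇔Covers gs) (hs , hs⊆gs , to (T⇔Covers hs) t) v u))

  Global-globalClause : ∀ hs → Global (globalClause hs) ⇔ Covers (λ _ → ⊤) hs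
  Global-globalClause hs = mk⇔
    (λ g → AllP.map⁻ (Global-⋀⁻ _ (proj₂ ∘ g)) ,
           λ v _ → AnyP.map⁻ (⊩-⋁⁻ _ (proj₁ (g v))))
    (λ (hs-global , covered) v →
      ⊩-⋁⁺ _ (AnyP.map⁺ (covered v tt)) , Global-⋀⁺ _ (AllP.map⁺ hs-global) v)

  Holds-□▸ : ∀ {w} hs → Holds w (□▸ hs) ⇔ Covers (R F w) hs
  Holds-□▸ hs = mk⇔
    (λ (g , s) → AllP.map⁻ (Global-⋀⁻ _ g) , λ v r → AnyP.map⁻ (⊩-⋁⁻ _ (s v r)))
    (λ (hs-global , covered) →
      Global-⋀⁺ _ (AllP.map⁺ hs-global) , λ v r → ⊩-⋁⁺ _ (AnyP.map⁺ (covered v r)))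

  Global-normal : ∀ {gs} → NormalForm φ gs → Global φ ⇔ Any (Global ∘ globalClause) (sublists gs)
  Global-normal {φ} {gs} nf = mk⇔ (λ g → to ∀φ⇔ λ v _ → g v) (λ h v → from ∀φ⇔ h v tt)
    where
    ∀φ⇔ : (∀ v → ⊤ → v ⊩ φ) ⇔ Any (Global ∘ globalClause) (sublists gs)
    ∀φ⇔ = ∀-normal {φ = φ} nf Global-globalClause

  normalForm-correct : (l : isMLA⁺ φ) → NormalForm φ (normalForm l)
  normalForm-correct (var p)   w = mk⇔ (λ s → here (⊩-verum , s)) λ { (here (_ , s)) → s }
  normalForm-correct (nvar p)  w = mk⇔ (λ s → here (⊩-verum , s)) λ { (here (_ , s)) → s }
  normalForm-correct (and l r) w = mk⇔
    (λ (s , t) → AnyP.cartesianProductWith⁺ _⊓_ (λ (c , s) (d , t) → (λ v → c v , d v) , s , t)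
                   (to (normalForm-correct l w) s) (to (normalForm-correct r w) t))
    (Product.map (from (normalForm-correct l w)) (from (normalForm-correct r w))
      ∘ AnyP.cartesianProductWith⁻ _⊓_ (λ (cd , s , t) → ((proj₁ ∘ cd) , s) , ((proj₂ ∘ cd) , t))
          (normalForm l) (normalForm r))
  normalForm-correct (or l r)  w = mk⇔
    [ AnyP.++⁺ˡ ∘ to (normalForm-correct l w) , AnyP.++⁺ʳ _ ∘ to (normalForm-correct r w) ]′
    (Sum.map (from (normalForm-correct l w)) (from (normalForm-correct r w)) ∘ AnyP.++⁻ (normalForm l))
  normalForm-correct (dia l)   w = mk⇔
    (λ (v , r , s) → AnyP.map⁺ (Any.map (λ (c , t) → c , v , r , t) (to (normalForm-correct l v) s)))
    (λ h → let _ , g∈ , c , v , r , t = find (AnyP.map⁻ {f = ◇▸} {P = Holds w} h)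
           in v , r , from (normalForm-correct l v) (lose g∈ (c , t)))
  normalForm-correct (box {φ} l) w = mk⇔ (AnyP.map⁺ ∘ to □φ⇔) (from □φ⇔ ∘ AnyP.map⁻)
    where
    □φ⇔ : w ⊩ □ φ ⇔ Any (Holds w ∘ □▸) (sublists (normalForm l))
    □φ⇔ = ∀-normal {φ = φ} (normalForm-correct l) Holds-□▸
  normalForm-correct (univ {φ} l) w = mk⇔
    (λ g → AnyP.map⁺ (Any.map (_, ⊩-verum w) (to 𝔸φ⇔ g)))
    (λ h → from 𝔸φ⇔ (Any.map proj₁ (AnyP.map⁻ h)))
    where
    𝔸φ⇔ : Global φ ⇔ Any (Global ∘ globalClause) (sublists (normalForm l))
    𝔸φ⇔ = Global-normal {φ = φ} (normalForm-correct l)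

  Global⇔translate : (l : isMLA⁺ φ) → ∀ w → Global φ ⇔ w ⊩ translate l
  Global⇔translate {φ} l w = mk⇔
    (λ g → ⊩-⋁𝔸⁺ _ (AnyP.map⁺ (to 𝔸φ⇔ g)))
    (λ s → from 𝔸φ⇔ (AnyP.map⁻ (⊩-⋁𝔸⁻ _ s)))
    where
    𝔸φ⇔ : Global φ ⇔ Any (Global ∘ globalClause) (sublists (normalForm l))
    𝔸φ⇔ = Global-normal {φ = φ} (normalForm-correct l)

translate-valid : ExcludedMiddle 0ℓ → (l : isMLA⁺ φ) (F : Frame) → F ⊨ φ ⇔ F ⊨ translate l
translate-valid em l F = mk⇔
  (λ F⊨φ V w → to (Global⇔translate V l w) (F⊨φ V))
  (λ F⊨θ V w → from (Global⇔translate V l w) (F⊨θ V w) w)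
  where open Semantics em

≤F-by-translation : (τ : ∀ {φ} → L φ → Fm) → (∀ {φ} (l : L φ) → L′ (τ l)) →
                    (∀ {φ} (l : L φ) F → F ⊨ φ ⇔ F ⊨ τ l) → L ≤F L′
≤F-by-translation {L′ = L′} τ τ-L′ τ-valid K (Γ , Γ-L , defines) = Γ′ , Γ′-L′ , λ F →
  (λ k → λ { _ (φ , γ , refl) → to (τ-valid (Γ-L φ γ) F) (proj₁ (defines F) k φ γ) }) ,
  (λ h → proj₂ (defines F) λ φ γ → from (τ-valid (Γ-L φ γ) F) (h _ (φ , γ , refl)))
  where
  Γ′ : Fm → Set
  Γ′ ψ = ∃ λ φ → Σ (Γ φ) λ γ → ψ ≡ τ (Γ-L φ γ)
  Γ′-L′ : ∀ ψ → Γ′ ψ → L′ ψ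
  Γ′-L′ _ (φ , γ , refl) = τ-L′ (Γ-L φ γ)

⊆⇒≤F : (∀ {φ} → L φ → L′ φ) → L ≤F L′
⊆⇒≤F L⊆L′ = ≤F-by-translation (λ {φ} _ → φ) L⊆L′ (λ _ _ → mk⇔ id id)

MLA⁺≤F⋁AML : ExcludedMiddle 0ℓ → isMLA⁺ ≤F is⋁AML
MLA⁺≤F⋁AML em = ≤F-by-translation translate translate-⋁AML (translate-valid em)

record BoundedMorphism (G H : Frame) : Set where
  field
    fun   : W G → W H
    forth : ∀ {a b} → R G a b → R H (fun a) (fun b)
    back  : ∀ {a y} → R H (fun a) y → ∃ λ b → R G a b × fun b ≡ y

module _ (f : BoundedMorphism G H) (V : Valuation H) where
  open BoundedMorphism f

  pullback : Valuation G
  pullback p a = V p (fun a)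

  ML-invariant : isML φ → ∀ a → sat G pullback a φ ⇔ sat H V (fun a) φ
  ML-invariant (var p)   a = mk⇔ id id
  ML-invariant (nvar p)  a = mk⇔ id id
  ML-invariant (and l r) a = mk⇔
    (Product.map (to (ML-invariant l a)) (to (ML-invariant r a)))
    (Product.map (from (ML-invariant l a)) (from (ML-invariant r a)))
  ML-invariant (or l r)  a = mk⇔
    (Sum.map (to (ML-invariant l a)) (to (ML-invariant r a)))
    (Sum.map (from (ML-invariant l a)) (from (ML-invariant r a)))
  ML-invariant (dia {ψ} l) a = mk⇔
    (λ (b , r , s) → fun b , forth r , to (ML-invariant l b) s)
    (λ (y , r , s) → let b , r′ , b↦y = back r
                     in b , r′ , from (ML-invariant l b) (subst (λ y → sat H V y ψ) (sym b↦y) s))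
  ML-invariant (box {ψ} l) a = mk⇔
    (λ s y r → let b , r′ , b↦y = back r
               in subst (λ y → sat H V y ψ) b↦y (to (ML-invariant l b) (s b r′)))
    (λ s b r → from (ML-invariant l b) (s (fun b) (forth r)))

  ⋁AML-reflect : is⋁AML φ → ∀ {x} a → sat H V x φ → sat G pullback a φ
  ⋁AML-reflect (clause l) a s b        = from (ML-invariant l b) (s (fun b))
  ⋁AML-reflect (or l r)   a (inj₁ s)   = inj₁ (⋁AML-reflect l a s)
  ⋁AML-reflect (or l r)   a (inj₂ s)   = inj₂ (⋁AML-reflect r a s)

_⊕_ : Frame → Frame → Frame
F ⊕ G = record { W = W F ⊎ W G ; R = R⊕ }
  where
  R⊕ : W F ⊎ W G → W F ⊎ W G → Set
  R⊕ (inj₁ a) (inj₁ b) = R F a b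
  R⊕ (inj₂ a) (inj₂ b) = R G a b
  R⊕ _        _        = ⊥

inj₁-bounded : BoundedMorphism F (F ⊕ G)
inj₁-bounded = record
  { fun = inj₁ ; forth = id ; back = λ { {y = inj₁ b} r → b , r , refl ; {y = inj₂ _} () } }

inj₂-bounded : BoundedMorphism G (F ⊕ G)
inj₂-bounded = record
  { fun = inj₂ ; forth = id ; back = λ { {y = inj₂ b} r → b , r , refl ; {y = inj₁ _} () } }

ML-valid-⊕ : isML φ → F ⊨ φ → G ⊨ φ → (F ⊕ G) ⊨ φ
ML-valid-⊕ l F⊨φ G⊨φ V (inj₁ a) = to (ML-invariant inj₁-bounded V l a) (F⊨φ _ a)
ML-valid-⊕ l F⊨φ G⊨φ V (inj₂ b) = to (ML-invariant inj₂-bounded V l b) (G⊨φ _ b)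

⋁AML-valid-⊕ʳ : is⋁AML φ → (F ⊕ G) ⊨ φ → G ⊨ φ
⋁AML-valid-⊕ʳ {F = F} {G = G} l F⊕G⊨φ V b =
  ⋁AML-reflect inj₂-bounded V⁺ l b (F⊕G⊨φ V⁺ (inj₂ b))
  where
  V⁺ : Valuation (F ⊕ G)
  V⁺ p = [ (λ _ → ⊥) , V p ]′

ML-definable⇒⊕-closed : Definable isML K → K F → K G → K (F ⊕ G)
ML-definable⇒⊕-closed {F = F} {G = G} (Γ , Γ-ML , defines) kF kG =
  proj₂ (defines (F ⊕ G)) λ φ γ →
    ML-valid-⊕ (Γ-ML φ γ) (proj₁ (defines F) kF φ γ) (proj₁ (defines G) kG φ γ)

⋁AML-definable⇒summand-closed : Definable is⋁AML K → K (F ⊕ G) → K G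
⋁AML-definable⇒summand-closed {F = F} {G = G} (Γ , Γ-⋁AML , defines) k =
  proj₂ (defines G) λ φ γ →
    ⋁AML-valid-⊕ʳ {F = F} (Γ-⋁AML φ γ) (proj₁ (defines (F ⊕ G)) k φ γ)

definable-by : L φ → (∀ F → K F ⇔ F ⊨ φ) → Definable L K
definable-by {φ = φ} l K⇔ = (_≡ φ) , (λ { _ refl → l }) , λ F →
  (λ k → λ { _ refl → to (K⇔ F) k }) , (λ h → from (K⇔ F) (h φ refl))

elementary-by : (σ : Sentence) → (∀ F → K F ⇔ F ⊨FO σ) → Elementary K
elementary-by σ K⇔ = (_≡ σ) , λ F →
  (λ k → λ { _ refl → to (K⇔ F) k }) , (λ h → from (K⇔ F) (h σ refl))

point loop : Frame
point = record { W = ⊤ ; R = λ _ _ → ⊥ }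
loop  = record { W = ⊤ ; R = λ _ _ → ⊤ }

AtMostOnePoint : FrameClass
AtMostOnePoint F = Lift (lsuc 0ℓ) ((a b : W F) → a ≡ b)

p∨𝔸¬p : Fm
p∨𝔸¬p = var 0 ∨' 𝔸 (nvar 0)

AtMostOnePoint⇔valid : ExcludedMiddle 0ℓ → ∀ F → AtMostOnePoint F ⇔ F ⊨ p∨𝔸¬p
AtMostOnePoint⇔valid em F = mk⇔ valid (λ F⊨ → lift λ a b → equal F⊨ a b)
  where
  valid : AtMostOnePoint F → F ⊨ p∨𝔸¬p
  valid (lift same) V w with em {V 0 w}
  ... | yes p = inj₁ p
  ... | no ¬p = inj₂ λ v p → ¬p (subst (V 0) (same v w) p)
  -- p is true exactly at a, so 𝔸¬p fails and p must hold at b.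
  equal : F ⊨ p∨𝔸¬p → (a b : W F) → a ≡ b
  equal F⊨ a b with F⊨ (λ _ x → x ≡ a) b
  ... | inj₁ b≡a = sym b≡a
  ... | inj₂ ¬p  = ⊥-elim (¬p a refl)

AtMostOnePoint-elementary : Elementary AtMostOnePoint
AtMostOnePoint-elementary =
  elementary-by {K = AtMostOnePoint} (all (all (eq (suc zero) zero))) λ _ → mk⇔ lower lift

MLA⁺≰ᵉML : ExcludedMiddle 0ℓ → ¬ (isMLA⁺ ≤Fᵉ isML)
MLA⁺≰ᵉML em MLA⁺≤ᵉML =
  two-points (ML-definable⇒⊕-closed {F = point} {G = point} ML-definable one-point one-point)
  where
  ML-definable : Definable isML AtMostOnePoint
  ML-definable = MLA⁺≤ᵉML AtMostOnePoint AtMostOnePoint-elementary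
    (definable-by {φ = p∨𝔸¬p} (or (var 0) (univ (nvar 0))) (AtMostOnePoint⇔valid em))
  one-point : AtMostOnePoint point
  one-point = lift λ _ _ → refl
  two-points : ¬ AtMostOnePoint (point ⊕ point)
  two-points (lift same) with same (inj₁ tt) (inj₂ tt)
  ... | ()

HasEdgeIfInhabited : FrameClass
HasEdgeIfInhabited F = Lift (lsuc 0ℓ) (W F → ∃₂ (R F))

𝔼◇⊤ : Fm
𝔼◇⊤ = 𝔼 (◇ verum)

HasEdgeIfInhabited⇔valid : ExcludedMiddle 0ℓ → ∀ F → HasEdgeIfInhabited F ⇔ F ⊨ 𝔼◇⊤
HasEdgeIfInhabited⇔valid em F = mk⇔ valid (λ F⊨ → lift (edge F⊨))
  where
  valid : HasEdgeIfInhabited F → F ⊨ 𝔼◇⊤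
  valid (lift edge) V w with edge w
  ... | a , b , r = a , b , r , Semantics.⊩-verum em {F} V b
  edge : F ⊨ 𝔼◇⊤ → W F → ∃₂ (R F)
  edge F⊨ w with F⊨ (λ _ _ → ⊥) w
  ... | a , b , r , _ = a , b , r

HasEdgeIfInhabited-elementary : Elementary HasEdgeIfInhabited
HasEdgeIfInhabited-elementary =
  elementary-by {K = HasEdgeIfInhabited} (all (ex (ex (rel (suc zero) zero)))) λ _ → mk⇔ lower lift

MLA≰ᵉ⋁AML : ExcludedMiddle 0ℓ → ¬ (isMLA ≤Fᵉ is⋁AML)
MLA≰ᵉ⋁AML em MLA≤ᵉ⋁AML =
  no-edge (⋁AML-definable⇒summand-closed {F = loop} ⋁AML-definable loop-edge)
  where
  ⋁AML-definable : Definable is⋁AML HasEdgeIfInhabited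
  ⋁AML-definable = MLA≤ᵉ⋁AML HasEdgeIfInhabited HasEdgeIfInhabited-elementary
    (definable-by {φ = 𝔼◇⊤} tt (HasEdgeIfInhabited⇔valid em))
  loop-edge : HasEdgeIfInhabited (loop ⊕ point)
  loop-edge = lift λ _ → inj₁ tt , inj₁ tt , tt
  no-edge : ¬ HasEdgeIfInhabited point
  no-edge (lift edge) = proj₂ (proj₂ (edge tt))

≤F⇒≤Fᵉ : L ≤F L′ → L ≤Fᵉ L′
≤F⇒≤Fᵉ L≤L′ K _ = L≤L′ K

strictly-below : L ≤F L′ → ¬ (L′ ≤Fᵉ L) → (L <F L′) × (L <Fᵉ L′)
strictly-below {L} {L′} L≤L′ L′≰ᵉL =
  (L≤L′ , L′≰ᵉL ∘ ≤F⇒≤Fᵉ {L′} {L}) , (≤F⇒≤Fᵉ {L} {L′} L≤L′ , L′≰ᵉL)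

proposition2 : ExcludedMiddle (lsuc (lsuc 0ℓ))
    → ((isML <F isMLA⁺) × (isMLA⁺ ≡F is⋁AML) × (is⋁AML <F isMLA))
      × ((isML <Fᵉ isMLA⁺) × (isMLA⁺ ≡Fᵉ is⋁AML) × (is⋁AML <Fᵉ isMLA))
proposition2 em =
  (proj₁ ML<MLA⁺ , MLA⁺≡⋁AML , proj₁ ⋁AML<MLA) ,
  (proj₂ ML<MLA⁺ , Product.map ≤F⇒≤Fᵉ ≤F⇒≤Fᵉ MLA⁺≡⋁AML , proj₂ ⋁AML<MLA)
  where
  em₀ : ExcludedMiddle 0ℓ
  em₀ = lowerEM em
  MLA⁺≡⋁AML : isMLA⁺ ≡F is⋁AML
  MLA⁺≡⋁AML = MLA⁺≤F⋁AML em₀ , ⊆⇒≤F ⋁AML⊆MLA⁺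
  ML<MLA⁺ : (isML <F isMLA⁺) × (isML <Fᵉ isMLA⁺)
  ML<MLA⁺ = strictly-below {isML} {isMLA⁺} (⊆⇒≤F ML⊆MLA⁺) (MLA⁺≰ᵉML em₀)
  ⋁AML<MLA : (is⋁AML <F isMLA) × (is⋁AML <Fᵉ isMLA)
  ⋁AML<MLA = strictly-below {is⋁AML} {isMLA} (⊆⇒≤F _) (MLA≰ᵉ⋁AML em₀)
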